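{- Let $G=(X,Y,E)$ be a chained complete bipartite graph with MCB-component family $\mathscr{C}=\{C_1,\dots,C_n\}$ labelled as in the definition, $n\ge 2$. For any ordering $\sigma$ of $X\cup Y$, $$I\big(s_{n-1},\sigma^{C_{n-1}\cup C_n},G[C_{n-1}\cup C_n]\big)-I\big(s_{n-1},\sigma^{C_{n-1}},G[C_{n-1}]\big)-I\big(s_{n-1},\sigma^{C_n},G[C_n]\big)\ \ge\ \big|g(s_{n-1},C_{n-1})-g(s_{n-1},C_n)\big|-g(s_{n-1},C_{n-1})-g(s_{n-1},C_n).$$
   Context: All graphs are finite, simple, undirected and connected. For a graph $G=(V,E)$ and an ordering (bijection) $\sigma:V\to\{1,\dots,|V|\}$, $I(v,\sigma,G)=\big|\,|\{u\in N(v): \sigma(u)<\sigma(v)\}|-|\{u\in N(v): \sigma(u)>\sigma(v)\}|\,\big|$. For $S'\subseteq V$, $\sigma^{S'}$ denotes the ordering of $S'$ preserving the relative order of $\sigma$, and $G[S']$ is the induced subgraph. An MCB-component family of $G$ is a family $\mathscr{C}$ of vertex subsets such that every edge lies within some $C\in\mathscr{C}$, each $G[C]$ is complete bipartite, and for each $C\in\mathscr{C}$ and $v\notin C$, $G[C\cup\{v\}]$ is not complete bipartite. A bipartite graph $G=(X,Y,E)$ is a chained complete bipartite graph if it has an MCB-component family labelled $\mathscr{C}=\{C_1,\dots,C_n\}$ with $|C_i\cap C_{i+1}|=1$ for $1\le i<n$ and $C_i\cap C_j=\emptyset$ whenever $|i-j|>1$. The unique vertex of $C_i\cap C_{i+1}$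 is denoted $s_i$. $X_i=X\cap C_i$, $Y_i=Y\cap C_i$. $g(s_i,C_j)=|N(s_i)\cap C_j|$, equal to $|Y_j|$ if $s_i\in X$ and $|X_j|$ if $s_i\in Y$. -}

module Defs where

open import Data.Bool using (Bool; true; false; _∧_; T)
open import Data.Nat using (ℕ; zero; suc; _≤_; _∸_; ∣_-_∣)
open import Data.Fin using (Fin; _<?_)
open import Data.Fin.Subset using (Subset; _∈_; _∉_; _∩_; _∪_; ∣_∣; ⁅_⁆; Nonempty; Empty; ∁)
open import Data.Fin.Permutation using (Permutation′; _⟨$⟩ʳ_)
open import Data.Vec using (lookup; tabulate)
open import Data.Product using (Σ; ∃; _×_; _,_)
open import Data.Sum using (_⊎_)
open import Data.Empty using (⊥)
open import Relation.Nullary using (¬_; ⌊_⌋)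
open import Relation.Binary.PropositionalEquality using (_≡_)
open import Function.Bundles using (_⇔_)

Adj : {N : ℕ} → (Fin N → Fin N → Bool) → Fin N → Fin N → Set
Adj adj u v = T (adj u v)

data Reach {N : ℕ} (adj : Fin N → Fin N → Bool) : Fin N → Fin N → Set where
  here : ∀ {u} → Reach adj u u
  step : ∀ {u w v} → Adj adj u w → Reach adj w v → Reach adj u v

record Graph : Set where
  field
    N       : ℕ
    adj     : Fin N → Fin N → Bool
    sym     : ∀ u v → Adj adj u v → Adj adj v u
    irrefl  : ∀ v → ¬ Adj adj v v
    connected : ∀ u v → Reach adj u v

record BipGraph : Set where
  field
    graph : Graph
  open Graph graph public
  field
    X : Subset N
    edges-cross : ∀ u v → Adj adj u v → (u ∈ X × v ∉ X) ⊎ (u ∉ X × v ∈ X)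
  Y : Subset N
  Y = ∁ X

module _ (G : Graph) where
  open Graph G

  nbhd : Fin N → Subset N
  nbhd v = tabulate (adj v)

  g : Fin N → Subset N → ℕ
  g s C = ∣ nbhd s ∩ C ∣

  -- I(v, σ^S, G[S]) for v ∈ S.  Since σ^S preserves the relative order
  -- of σ on S and G[S] has exactly the edges of G between vertices of S,
  -- the neighbours of v in G[S] are the u ∈ S with u ~ v, and
  -- σ^S(u) < σ^S(v) iff σ(u) < σ(v).  (Taking S = V gives I(v,σ,G).)
  earlier : Subset N → Permutation′ N → Fin N → ℕ
  earlier S σ v = ∣ tabulate (λ u → lookup S u ∧ adj v u ∧ ⌊ (σ ⟨$⟩ʳ u) <? (σ ⟨$⟩ʳ v) ⌋) ∣

  later : Subset N → Permutation′ N → Fin N → ℕ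
  later S σ v = ∣ tabulate (λ u → lookup S u ∧ adj v u ∧ ⌊ (σ ⟨$⟩ʳ v) <? (σ ⟨$⟩ʳ u) ⌋) ∣

  Iind : Fin N → Permutation′ N → Subset N → ℕ
  Iind v σ S = ∣ earlier S σ v - later S σ v ∣

  IsCompleteBipartite : Subset N → Set
  IsCompleteBipartite C =
    Σ (Subset N) λ A → Σ (Subset N) λ B →
      (A ∪ B ≡ C) × Empty (A ∩ B) × Nonempty A × Nonempty B ×
      (∀ u v → u ∈ C → v ∈ C →
         Adj adj u v ⇔ ((u ∈ A × v ∈ B) ⊎ (u ∈ B × v ∈ A)))

  IsMCBFamily : (n : ℕ) → (ℕ → Subset N) → Set
  IsMCBFamily n C =
    (∀ u v → Adj adj u v → ∃ λ i → 1 ≤ i × i ≤ n × u ∈ C i × v ∈ C i) ×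
    (∀ i → 1 ≤ i → i ≤ n → IsCompleteBipartite (C i)) ×
    (∀ i → 1 ≤ i → i ≤ n → ∀ v → v ∉ C i → ¬ IsCompleteBipartite (C i ∪ ⁅ v ⁆))

  IsChain : (n : ℕ) → (ℕ → Subset N) → Set
  IsChain n C =
    IsMCBFamily n C ×
    (∀ i → 1 ≤ i → suc i ≤ n → ∣ C i ∩ C (suc i) ∣ ≡ 1) ×
    (∀ i j → 1 ≤ i → i ≤ n → 1 ≤ j → j ≤ n → suc (suc i) ≤ j → Empty (C i ∩ C j))

-- Since C₁ ∩ C₂ = {s} and s is not its own neighbour, the neighbours of s
-- in C₁ ∪ C₂ placed before (after) s split into those in C₁ and those in
-- C₂, and each of these four counts is bounded by the degree of s into the
-- respective block.  Writing x, y for the signed imbalances of s inside C₁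
-- and C₂, with |x| ≤ a = g(s,C₁) and |y| ≤ b = g(s,C₂), the claim becomes
-- |x| + |y| − |x + y| ≤ a + b − |a − b| = 2 min(a, b), and the left side is
-- at most 2 min(|x|, |y|) by the triangle inequality.
module Submission where

open import Defs
open import Data.Nat using (ℕ; _≤_; _∸_; ∣_-_∣)
open import Data.Integer using (+_; _-_) renaming (_≤_ to _≤ℤ_)
open import Data.Fin using (Fin)
open import Data.Fin.Subset using (Subset; _∈_; _∪_)
open import Data.Fin.Permutation using (Permutation′)

import Algebra.Properties.CommutativeSemigroup as CommSemigroupProperties
open import Data.Bool using (Bool; true; _∧_; T)
open import Data.Bool.Properties using (∧-conicalˡ)
open import Data.Empty using (⊥-elim)
open import Data.Fin using (_≟_; _<?_) renaming (zero to fzero; suc to fsuc)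
open import Data.Fin.Permutation using (_⟨$⟩ʳ_)
open import Data.Fin.Subset using (_∉_; _⊆_; _∩_; Empty; inside; outside)
open import Data.Fin.Subset using () renaming (∣_∣ to card)
open import Data.Fin.Subset.Properties
  using (drop-∷-Empty; p⊆q⇒∣p∣≤∣q∣; ∣⁅x⁆∣≡1; x∈⁅y⁆⇒x≡y; x∈p∧x≢y⇒x∈p-y; x∈p⇒∣p-x∣<∣p∣;
         x∈p∩q⁺; x∈p∩q⁻; ∩-distribʳ-∪)
open import Data.Integer using (ℤ; +≤+) renaming (_+_ to _+ℤ_; -_ to -ℤ_)
import Data.Integer.Properties as ℤ
open import Data.Integer.Tactic.RingSolver using (solve-∀)
open import Data.Nat using (_+_; suc; s≤s; z≤n)
open import Data.Nat.Properties hiding (_≟_; _<?_)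
open import Data.Product using (_,_)
open import Data.Sum using (inj₁; inj₂)
open import Data.Unit using (tt)
open import Data.Vec using (_∷_; []; here; lookup; tabulate)
open import Data.Vec.Properties using (lookup∘tabulate; []=⇒lookup; lookup⇒[]=)
open import Function using (_∘_)
open import Relation.Binary.PropositionalEquality
open import Relation.Nullary using (yes; no; ⌊_⌋)

open CommSemigroupProperties +-commutativeSemigroup using (xy∙z≈xz∙y)

∣n-o∣≤∣m+n-l+o∣+∣m-l∣ : ∀ m n l o → ∣ n - o ∣ ≤ ∣ (m + n) - (l + o) ∣ + ∣ m - l ∣
∣n-o∣≤∣m+n-l+o∣+∣m-l∣ m n l o = begin
  ∣ n - o ∣                                   ≡⟨ ∣m+n-m+o∣≡∣n-o∣ m n o ⟨
  ∣ m + n - m + o ∣                           ≤⟨ ∣-∣-triangle (m + n) (l + o) (m + o) ⟩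
  ∣ (m + n) - (l + o) ∣ + ∣ l + o - m + o ∣   ≡⟨ cong (λ d → ∣ (m + n) - (l + o) ∣ + d) ∣l+o-m+o∣≡∣m-l∣ ⟩
  ∣ (m + n) - (l + o) ∣ + ∣ m - l ∣           ∎
  where
  open ≤-Reasoning
  ∣l+o-m+o∣≡∣m-l∣ : ∣ l + o - m + o ∣ ≡ ∣ m - l ∣
  ∣l+o-m+o∣≡∣m-l∣ = begin-equality
    ∣ l + o - m + o ∣  ≡⟨ cong₂ ∣_-_∣ (+-comm l o) (+-comm m o) ⟩
    ∣ o + l - o + m ∣  ≡⟨ ∣m+n-m+o∣≡∣n-o∣ o l m ⟩
    ∣ l - m ∣          ≡⟨ ∣-∣-comm l m ⟩
    ∣ m - l ∣          ∎

∣m-n∣≤o : ∀ {m n o} → m ≤ o → n ≤ o → ∣ m - n ∣ ≤ o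
∣m-n∣≤o {m} {n} m≤o n≤o = ≤-trans (∣m-n∣≤m⊔n m n) (⊔-lub m≤o n≤o)

b∸a+x+y≤z+a+b : ∀ {a b x y z} → a ≤ b → x ≤ a → y ≤ z + x → b ∸ a + x + y ≤ z + a + b
b∸a+x+y≤z+a+b {a} {b} {x} {y} {z} a≤b x≤a y≤z+x = begin
  b ∸ a + x + y        ≤⟨ +-mono-≤ (+-monoʳ-≤ (b ∸ a) x≤a) (≤-trans y≤z+x (+-monoʳ-≤ z x≤a)) ⟩
  b ∸ a + a + (z + a)  ≡⟨ cong (_+ (z + a)) (m∸n+n≡m a≤b) ⟩
  b + (z + a)          ≡⟨ +-comm b (z + a) ⟩
  z + a + b            ∎
  where open ≤-Reasoning

∣a-b∣+x+y≤z+a+b : ∀ {a b x y z} → x ≤ a → y ≤ b → x ≤ z + y → y ≤ z + x →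
                  ∣ a - b ∣ + x + y ≤ z + a + b
∣a-b∣+x+y≤z+a+b {a} {b} {x} {y} {z} x≤a y≤b x≤z+y y≤z+x with ≤-total a b
... | inj₁ a≤b = begin
  ∣ a - b ∣ + x + y  ≡⟨ cong (λ d → d + x + y) (m≤n⇒∣m-n∣≡n∸m a≤b) ⟩
  b ∸ a + x + y      ≤⟨ b∸a+x+y≤z+a+b a≤b x≤a y≤z+x ⟩
  z + a + b          ∎
  where open ≤-Reasoning
... | inj₂ b≤a = begin
  ∣ a - b ∣ + x + y  ≡⟨ cong (λ d → d + x + y) (m≤n⇒∣n-m∣≡n∸m b≤a) ⟩
  a ∸ b + x + y      ≡⟨ xy∙z≈xz∙y (a ∸ b) x y ⟩
  a ∸ b + y + x      ≤⟨ b∸a+x+y≤z+a+b b≤a y≤b x≤z+y ⟩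
  z + b + a          ≡⟨ xy∙z≈xz∙y z b a ⟩
  z + a + b          ∎
  where open ≤-Reasoning

m+q+r≤p+n+o⇒m-n-o≤p-q-r : ∀ {m n o p q r} → m + q + r ≤ p + n + o →
                          + m - + n - + o ≤ℤ + p - + q - + r
m+q+r≤p+n+o⇒m-n-o≤p-q-r {m} {n} {o} {p} {q} {r} m+q+r≤p+n+o = begin
  + m - + n - + o                ≡⟨ add-to-both (+ m) (+ n) (+ o) (+ q) (+ r) ⟩
  + (m + q + r) - t              ≤⟨ ℤ.+-monoˡ-≤ (-ℤ t) (+≤+ m+q+r≤p+n+o) ⟩
  + (p + n + o) - t              ≡⟨ cancel (+ p) (+ n) (+ o) (+ q) (+ r) ⟩
  + p - + q - + r                ∎
  where
  open ℤ.≤-Reasoning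
  t : ℤ
  t = + (n + o + q + r)
  add-to-both : ∀ i j k l₁ l₂ → i - j - k ≡ (i +ℤ l₁ +ℤ l₂) - (j +ℤ k +ℤ l₁ +ℤ l₂)
  add-to-both = solve-∀
  cancel : ∀ i j k l₁ l₂ → (i +ℤ j +ℤ k) - (j +ℤ k +ℤ l₁ +ℤ l₂) ≡ i - l₁ - l₂
  cancel = solve-∀

∣a-b∣-a-b≤∣e-l∣-∣e₁-l₁∣-∣e₂-l₂∣ : ∀ {a b e₁ l₁ e₂ l₂} → e₁ ≤ a → l₁ ≤ a → e₂ ≤ b → l₂ ≤ b →
  + ∣ a - b ∣ - + a - + b ≤ℤ + ∣ (e₁ + e₂) - (l₁ + l₂) ∣ - + ∣ e₁ - l₁ ∣ - + ∣ e₂ - l₂ ∣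
∣a-b∣-a-b≤∣e-l∣-∣e₁-l₁∣-∣e₂-l₂∣ {a} {b} {e₁} {l₁} {e₂} {l₂} e₁≤a l₁≤a e₂≤b l₂≤b =
  m+q+r≤p+n+o⇒m-n-o≤p-q-r {∣ a - b ∣} {a} {b} {∣ (e₁ + e₂) - (l₁ + l₂) ∣} {∣ e₁ - l₁ ∣} {∣ e₂ - l₂ ∣}
    (∣a-b∣+x+y≤z+a+b (∣m-n∣≤o e₁≤a l₁≤a) (∣m-n∣≤o e₂≤b l₂≤b)
      ∣e₁-l₁∣≤∣e-l∣+∣e₂-l₂∣ (∣n-o∣≤∣m+n-l+o∣+∣m-l∣ e₁ e₂ l₁ l₂))
  where
  ∣e₁-l₁∣≤∣e-l∣+∣e₂-l₂∣ : ∣ e₁ - l₁ ∣ ≤ ∣ (e₁ + e₂) - (l₁ + l₂) ∣ + ∣ e₂ - l₂ ∣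
  ∣e₁-l₁∣≤∣e-l∣+∣e₂-l₂∣ = subst (λ d → ∣ e₁ - l₁ ∣ ≤ d + ∣ e₂ - l₂ ∣) (cong₂ ∣_-_∣ (+-comm e₂ e₁) (+-comm l₂ l₁))
                   (∣n-o∣≤∣m+n-l+o∣+∣m-l∣ e₂ e₁ l₂ l₁)

∣p∪q∣≡∣p∣+∣q∣ : ∀ {n} {p q : Subset n} → Empty (p ∩ q) → card (p ∪ q) ≡ card p + card q
∣p∪q∣≡∣p∣+∣q∣ {p = []}          {[]}          _ = refl
∣p∪q∣≡∣p∣+∣q∣ {p = outside ∷ p} {outside ∷ q} e = ∣p∪q∣≡∣p∣+∣q∣ (drop-∷-Empty e)
∣p∪q∣≡∣p∣+∣q∣ {p = inside  ∷ p} {outside ∷ q} e = cong suc (∣p∪q∣≡∣p∣+∣q∣ (drop-∷-Empty e))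
∣p∪q∣≡∣p∣+∣q∣ {p = outside ∷ p} {inside  ∷ q} e =
  trans (cong suc (∣p∪q∣≡∣p∣+∣q∣ (drop-∷-Empty e))) (sym (+-suc (card p) (card q)))
∣p∪q∣≡∣p∣+∣q∣ {p = inside  ∷ p} {inside  ∷ q} e = ⊥-elim (e (fzero , here))

x∈p⇒1≤∣p∣ : ∀ {n} {p : Subset n} {x} → x ∈ p → 1 ≤ card p
x∈p⇒1≤∣p∣ {p = p} {x} x∈p = subst (_≤ card p) (∣⁅x⁆∣≡1 x)
  (p⊆q⇒∣p∣≤∣q∣ (λ y∈⁅x⁆ → subst (_∈ p) (sym (x∈⁅y⁆⇒x≡y x y∈⁅x⁆)) x∈p))

∣p∣≡1⇒x∈p⇒y∈p⇒x≡y : ∀ {n} {p : Subset n} {x y} → card p ≡ 1 → x ∈ p → y ∈ p → x ≡ y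
∣p∣≡1⇒x∈p⇒y∈p⇒x≡y {x = x} {y} ∣p∣≡1 x∈p y∈p with x ≟ y
... | yes x≡y = x≡y
... | no x≢y  =
  ⊥-elim (<⇒≱ (<-≤-trans (x∈p⇒∣p-x∣<∣p∣ y∈p) (≤-reflexive ∣p∣≡1)) (x∈p⇒1≤∣p∣ (x∈p∧x≢y⇒x∈p-y x∈p x≢y)))

∈-tabulate⁻ : ∀ {n} {f : Fin n → Bool} {x} → x ∈ tabulate f → f x ≡ true
∈-tabulate⁻ {f = f} {x} x∈ = trans (sym (lookup∘tabulate f x)) ([]=⇒lookup x∈)

tabulate-∧ : ∀ {n} (p : Subset n) (f : Fin n → Bool) → tabulate (λ i → lookup p i ∧ f i) ≡ p ∩ tabulate f
tabulate-∧ []      f = refl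
tabulate-∧ (x ∷ p) f = cong (x ∧ f fzero ∷_) (tabulate-∧ p (f ∘ fsuc))

module _ (G : Graph) where
  open Graph G using (N; adj; irrefl)

  nbhdWith : Fin N → (Fin N → Bool) → Subset N
  nbhdWith v P = tabulate (λ u → adj v u ∧ P u)

  -- earlier S σ v and later S σ v are definitionally neighboursIn S v P for
  -- P = "before v in σ" and P = "after v in σ" respectively.
  neighboursIn : Subset N → Fin N → (Fin N → Bool) → ℕ
  neighboursIn S v P = card (tabulate (λ u → lookup S u ∧ adj v u ∧ P u))

  neighboursIn≡∣S∩nbhdWith∣ : ∀ S v P → neighboursIn S v P ≡ card (S ∩ nbhdWith v P)
  neighboursIn≡∣S∩nbhdWith∣ S v P = cong card (tabulate-∧ S (λ u → adj v u ∧ P u))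

  v∉nbhdWith : ∀ v P → v ∉ nbhdWith v P
  v∉nbhdWith v P v∈ = irrefl v (subst T (sym (∧-conicalˡ _ _ (∈-tabulate⁻ v∈))) tt)

  nbhdWith⊆nbhd : ∀ v P → nbhdWith v P ⊆ nbhd G v
  nbhdWith⊆nbhd v P {u} u∈ =
    lookup⇒[]= u (nbhd G v) (trans (lookup∘tabulate (adj v) u) (∧-conicalˡ _ _ (∈-tabulate⁻ u∈)))

  neighboursIn≤g : ∀ S v P → neighboursIn S v P ≤ g G v S
  neighboursIn≤g S v P = begin
    neighboursIn S v P       ≡⟨ neighboursIn≡∣S∩nbhdWith∣ S v P ⟩
    card (S ∩ nbhdWith v P)  ≤⟨ p⊆q⇒∣p∣≤∣q∣ S∩nbhdWith⊆nbhd∩S ⟩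
    g G v S                  ∎
    where
    open ≤-Reasoning
    S∩nbhdWith⊆nbhd∩S : S ∩ nbhdWith v P ⊆ nbhd G v ∩ S
    S∩nbhdWith⊆nbhd∩S u∈ with x∈p∩q⁻ S _ u∈
    ... | u∈S , u∈E = x∈p∩q⁺ (nbhdWith⊆nbhd v P u∈E , u∈S)

  neighboursIn-∪ : ∀ {C₁ C₂ v} P → card (C₁ ∩ C₂) ≡ 1 → v ∈ C₁ → v ∈ C₂ →
    neighboursIn (C₁ ∪ C₂) v P ≡ neighboursIn C₁ v P + neighboursIn C₂ v P
  neighboursIn-∪ {C₁} {C₂} {v} P ∣C₁∩C₂∣≡1 v∈C₁ v∈C₂ = begin
    neighboursIn (C₁ ∪ C₂) v P               ≡⟨ neighboursIn≡∣S∩nbhdWith∣ (C₁ ∪ C₂) v P ⟩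
    card ((C₁ ∪ C₂) ∩ E)                     ≡⟨ cong card (∩-distribʳ-∪ E C₁ C₂) ⟩
    card ((C₁ ∩ E) ∪ (C₂ ∩ E))               ≡⟨ ∣p∪q∣≡∣p∣+∣q∣ disjoint ⟩
    card (C₁ ∩ E) + card (C₂ ∩ E)            ≡⟨ cong₂ _+_ (neighboursIn≡∣S∩nbhdWith∣ C₁ v P)
                                                         (neighboursIn≡∣S∩nbhdWith∣ C₂ v P) ⟨
    neighboursIn C₁ v P + neighboursIn C₂ v P ∎
    where
    open ≡-Reasoning
    E : Subset N
    E = nbhdWith v P
    -- the only common vertex of C₁ and C₂ is v itself, which is not in E
    disjoint : Empty ((C₁ ∩ E) ∩ (C₂ ∩ E))
    disjoint (u , u∈) with x∈p∩q⁻ _ _ u∈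
    ... | u∈C₁∩E , u∈C₂∩E with x∈p∩q⁻ C₁ E u∈C₁∩E | x∈p∩q⁻ C₂ E u∈C₂∩E
    ... | u∈C₁ , u∈E | u∈C₂ , _ = v∉nbhdWith v P (subst (_∈ E) u≡v u∈E)
      where
      u≡v : u ≡ v
      u≡v = ∣p∣≡1⇒x∈p⇒y∈p⇒x≡y ∣C₁∩C₂∣≡1 (x∈p∩q⁺ (u∈C₁ , u∈C₂)) (x∈p∩q⁺ (v∈C₁ , v∈C₂))

  Iind-∪ : ∀ {C₁ C₂} σ v → card (C₁ ∩ C₂) ≡ 1 → v ∈ C₁ → v ∈ C₂ →
    + ∣ g G v C₁ - g G v C₂ ∣ - + g G v C₁ - + g G v C₂
      ≤ℤ + Iind G v σ (C₁ ∪ C₂) - + Iind G v σ C₁ - + Iind G v σ C₂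
  Iind-∪ {C₁} {C₂} σ v ∣C₁∩C₂∣≡1 v∈C₁ v∈C₂ =
    subst₂ (λ e l → + ∣ g G v C₁ - g G v C₂ ∣ - + g G v C₁ - + g G v C₂
                      ≤ℤ + ∣ e - l ∣ - + Iind G v σ C₁ - + Iind G v σ C₂)
      (sym (neighboursIn-∪ before ∣C₁∩C₂∣≡1 v∈C₁ v∈C₂))
      (sym (neighboursIn-∪ after ∣C₁∩C₂∣≡1 v∈C₁ v∈C₂))
      (∣a-b∣-a-b≤∣e-l∣-∣e₁-l₁∣-∣e₂-l₂∣
        (neighboursIn≤g C₁ v before) (neighboursIn≤g C₁ v after)
        (neighboursIn≤g C₂ v before) (neighboursIn≤g C₂ v after))
    where
    before after : Fin N → Bool
    before u = ⌊ σ ⟨$⟩ʳ u <? σ ⟨$⟩ʳ v ⌋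
    after  u = ⌊ σ ⟨$⟩ʳ v <? σ ⟨$⟩ʳ u ⌋

lemma6 : (G : BipGraph) (n : ℕ) (C : ℕ → Subset (BipGraph.N G)) →
    2 ≤ n → IsChain (BipGraph.graph G) n C →
    (σ : Permutation′ (BipGraph.N G)) (s : Fin (BipGraph.N G)) →
    s ∈ C (n ∸ 1) → s ∈ C n →
    (+ ∣ g (BipGraph.graph G) s (C (n ∸ 1)) - g (BipGraph.graph G) s (C n) ∣)
      - (+ g (BipGraph.graph G) s (C (n ∸ 1))) - (+ g (BipGraph.graph G) s (C n))
    ≤ℤ
    (+ Iind (BipGraph.graph G) s σ (C (n ∸ 1) ∪ C n))
      - (+ Iind (BipGraph.graph G) s σ (C (n ∸ 1)))
      - (+ Iind (BipGraph.graph G) s σ (C n))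
lemma6 G (suc (suc k)) C (s≤s (s≤s z≤n)) (_ , ∣Cᵢ∩Cᵢ₊₁∣≡1 , _) σ s s∈Cₙ₋₁ s∈Cₙ =
  Iind-∪ (BipGraph.graph G) σ s (∣Cᵢ∩Cᵢ₊₁∣≡1 (suc k) (s≤s z≤n) ≤-refl) s∈Cₙ₋₁ s∈Cₙ
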